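{- Let $T$ be a complete theory and $1<k<\omega$. If $\varphi(x;y)$ is $\mathrm{PM}^{(k+1)}$ in $T$, then the formula $\psi(x;y_0\dots y_k)=\bigwedge_{i<k+1}\varphi(x;y_i)$ is $\mathrm{PM}^{(k)}$ in $T$.
   Context: Identify $n<\omega$ with $\{0,\dots,n-1\}$. An $n$-pattern is $(\mathcal{C},\mathcal{I})$ with $\mathcal{C},\mathcal{I}\subseteq(\mathcal{P}(n)\times\mathcal{P}(n))\setminus\{(\emptyset,\emptyset)\}$. A formula $\theta(x;z)$ exhibits it in $T$ if there are $b_0,\dots,b_{n-1}$ in a monster model of $T$ such that for each $(A^+,A^-)\in\mathcal{C}$ the type $\{\theta(x;b_i):i\in A^+\}\cup\{\neg\theta(x;b_j):j\in A^-\}$ is consistent and for each $(Z^+,Z^-)\in\mathcal{I}$ the analogous type is inconsistent. A pattern is reasonable if (i) for all $(Z^+,Z^-)\in\mathcal{I}$, $(Y^+,Y^-)\in\mathcal{C}$ some $\epsilon\in\{+,-\}$ has $Z^\epsilon\not\subseteq Y^\epsilon$; (ii),(iii) $X^+\cap X^-=\emptyset$ for every condition. It is positive if every condition has $X^-=\emptyset$. For $1<m<\omega$, $\theta$ is $\mathrm{PM}^{(m)}$ in $T$ if for every $n<\omega$ it exhibits every reasonable positive $n$-pattern all of whose inconsistency conditions $(Z^+,\emptyset)$ satisfy $|Z^+|=m$. -}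

module Defs where

open import Level using (0ℓ)
open import Data.Nat using (ℕ; suc)
open import Data.Fin using (Fin)
open import Data.Fin.Subset using (Subset; _∈_; _⊆_; ∣_∣) renaming (⊥ to ∅)
open import Data.Product using (Σ; ∃; _×_; _,_; proj₁; proj₂)
open import Data.Sum using (_⊎_)
open import Data.Empty using (⊥)
open import Relation.Nullary using (¬_)
open import Relation.Binary.PropositionalEquality using (_≡_)

Cond : ℕ → Set
Cond n = Subset n × Subset n

record Pattern (n : ℕ) : Set₁ where
  field
    C : Cond n → Set
    I : Cond n → Set
    C-nonempty : ¬ C (∅ , ∅)
    I-nonempty : ¬ I (∅ , ∅)
open Pattern public

-- Semantics: a formula θ(x;z) is given by its interpretation in a model M of T,
-- i.e. a relation between x-tuples (type X) and z-tuples (type Z).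
-- x realizes the finite partial type {θ(x;b_i) : i ∈ A⁺} ∪ {¬θ(x;b_j) : j ∈ A⁻}.
Realizes : {X Z : Set} (θ : X → Z → Set) {n : ℕ} (b : Fin n → Z) → Cond n → X → Set
Realizes θ b (A⁺ , A⁻) x = (∀ i → i ∈ A⁺ → θ x (b i)) × (∀ j → j ∈ A⁻ → ¬ θ x (b j))

-- A finite partial type over M is consistent iff it is realized in M.
Consistent : {X Z : Set} (θ : X → Z → Set) {n : ℕ} (b : Fin n → Z) → Cond n → Set
Consistent {X} θ b c = Σ X (Realizes θ b c)

Exhibits : {X Z : Set} (θ : X → Z → Set) {n : ℕ} → Pattern n → Set
Exhibits {Z = Z} θ {n} P =
  Σ (Fin n → Z) λ b →
    (∀ c → C P c → Consistent θ b c) × (∀ c → I P c → ¬ Consistent θ b c)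

Reasonable : {n : ℕ} → Pattern n → Set
Reasonable P =
  (∀ z y → I P z → C P y → (¬ (proj₁ z ⊆ proj₁ y)) ⊎ (¬ (proj₂ z ⊆ proj₂ y)))
  × (∀ z → I P z → ∀ i → i ∈ proj₁ z → i ∈ proj₂ z → ⊥)
  × (∀ y → C P y → ∀ i → i ∈ proj₁ y → i ∈ proj₂ y → ⊥)

Positive : {n : ℕ} → Pattern n → Set
Positive P = (∀ c → C P c → proj₂ c ≡ ∅) × (∀ c → I P c → proj₂ c ≡ ∅)

-- θ is PM^(m) (the side condition 1 < m is imposed where PM is used).
PM : (m : ℕ) {X Z : Set} (θ : X → Z → Set) → Set₁
PM m θ = ∀ (n : ℕ) (P : Pattern n) → Reasonable P → Positive P →
         (∀ z → I P z → ∣ proj₁ z ∣ ≡ m) → Exhibits θ P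

BigConj : (k : ℕ) {X Y : Set} (φ : X → Y → Set) → X → (Fin (suc k) → Y) → Set
BigConj k φ x ys = ∀ i → φ x (ys i)

-- Adjoin a new parameter, index 0, to the positive part of every condition of a pattern P.
-- This cone over P is again reasonable and positive, with inconsistency conditions of size
-- k + 1, so φ exhibits it with some c₀, …, cₙ. Put bᵢ = (cᵢ₊₁, c₀, …, c₀); then
-- ψ(x; bᵢ) ↔ φ(x; cᵢ₊₁) ∧ φ(x; c₀), and a realisation of a condition of P by ψ on the b's
-- is a realisation of its cone by φ on the c's as soon as φ(x; c₀) holds, which a nonempty
-- positive part guarantees; the inconsistency conditions of P have size k ≥ 1.
module Submission where

open import Defs
open import Data.Nat using (ℕ; suc; _<_; z<s; s≤s)
open import Data.Fin using (Fin; zero; suc)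
open import Data.Fin.Subset using (Subset; _∈_; _⊆_; ∣_∣; Nonempty; inside; outside)
open import Data.Fin.Subset.Properties using (drop-there; drop-∷-⊆)
open import Data.Vec using (_∷_; here; there)
open import Data.Product using (_,_; proj₁; proj₂)
import Data.Product as Product
open import Data.Sum using (_⊎_)
import Data.Sum as Sum
open import Data.Empty using (⊥)
open import Function using (_∘_)
open import Relation.Nullary using (¬_)
open import Relation.Binary.PropositionalEquality using (_≡_; cong; subst; sym)

private
  variable
    n m : ℕ
    X Y : Set

0<∣p∣⇒Nonempty : (p : Subset n) → 0 < ∣ p ∣ → Nonempty p
0<∣p∣⇒Nonempty (inside ∷ p)  _     = zero , here
0<∣p∣⇒Nonempty (outside ∷ p) 0<∣p∣ = Product.map suc there (0<∣p∣⇒Nonempty p 0<∣p∣)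

coneCond : Cond n → Cond (suc n)
coneCond (A⁺ , A⁻) = inside ∷ A⁺ , outside ∷ A⁻

data Coned (R : Cond n → Set) : Cond (suc n) → Set where
  coned : ∀ {A} → R A → Coned R (coneCond A)

cone : Pattern n → Pattern (suc n)
cone P = record
  { C          = Coned (C P)
  ; I          = Coned (I P)
  ; C-nonempty = λ ()
  ; I-nonempty = λ ()
  }

coneCond-disjoint : (A : Cond n) → (∀ i → i ∈ proj₁ A → i ∈ proj₂ A → ⊥) →
                    ∀ i → i ∈ proj₁ (coneCond A) → i ∈ proj₂ (coneCond A) → ⊥
coneCond-disjoint A disjoint (suc i) i∈A⁺ i∈A⁻ = disjoint i (drop-there i∈A⁺) (drop-there i∈A⁻)

cone-reasonable : (P : Pattern n) → Reasonable P → Reasonable (cone P)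
cone-reasonable P (separated , I-disjoint , C-disjoint) =
  separated′ , (λ { _ (coned {Z} iZ) → coneCond-disjoint Z (I-disjoint Z iZ) })
             , (λ { _ (coned {Y} cY) → coneCond-disjoint Y (C-disjoint Y cY) })
  where
  separated′ : ∀ z y → I (cone P) z → C (cone P) y →
               ¬ (proj₁ z ⊆ proj₁ y) ⊎ ¬ (proj₂ z ⊆ proj₂ y)
  separated′ _ _ (coned {Z} iZ) (coned {Y} cY) =
    Sum.map (_∘ drop-∷-⊆) (_∘ drop-∷-⊆) (separated Z Y iZ cY)

cone-positive : (P : Pattern n) → Positive P → Positive (cone P)
cone-positive _ (C-positive , I-positive) =
  (λ { _ (coned {Y} cY) → cong (outside ∷_) (C-positive Y cY) }) ,
  (λ { _ (coned {Z} iZ) → cong (outside ∷_) (I-positive Z iZ) })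

cone-size : (P : Pattern n) → (∀ z → I P z → ∣ proj₁ z ∣ ≡ m) →
            ∀ z → I (cone P) z → ∣ proj₁ z ∣ ≡ suc m
cone-size _ size _ (coned {Z} iZ) = cong suc (size Z iZ)

pairTuple : Y → Y → Fin (suc (suc m)) → Y
pairTuple a b zero    = a
pairTuple a b (suc _) = b

BigConj-pairTuple : (φ : X → Y → Set) {x : X} {a b : Y} → φ x a → φ x b →
                    BigConj (suc m) φ x (pairTuple a b)
BigConj-pairTuple φ φa φb zero    = φa
BigConj-pairTuple φ φa φb (suc _) = φb

module _ (φ : X → Y → Set) (c : Fin (suc n) → Y) where

  apexTuples : Fin n → Fin (suc (suc m)) → Y
  apexTuples i = pairTuple (c (suc i)) (c zero)

  realizes-cone⇒realizes-BigConj : ∀ {A x} → Realizes φ c (coneCond A) x →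
                                   Realizes (BigConj (suc m) φ) apexTuples A x
  realizes-cone⇒realizes-BigConj (pos , neg) =
    (λ i i∈A⁺ → BigConj-pairTuple φ (pos (suc i) (there i∈A⁺)) (pos zero here)) ,
    (λ j j∈A⁻ all → neg (suc j) (there j∈A⁻) (all zero))

  realizes-BigConj⇒realizes-cone : ∀ {A x} → φ x (c zero) →
                                   Realizes (BigConj (suc m) φ) apexTuples A x →
                                   Realizes φ c (coneCond A) x
  realizes-BigConj⇒realizes-cone {x = x} φc₀ (pos , neg) = pos′ , neg′
    where
    pos′ : ∀ i → i ∈ inside ∷ _ → φ x (c i)
    pos′ zero    _     = φc₀
    pos′ (suc i) i∈A⁺ = pos i (drop-there i∈A⁺) zero
    neg′ : ∀ j → j ∈ outside ∷ _ → ¬ φ x (c j)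
    neg′ (suc j) j∈A⁻ φcⱼ = neg j (drop-there j∈A⁻) (BigConj-pairTuple φ φcⱼ φc₀)

BigConj-exhibits-of-cone : (φ : X → Y → Set) (P : Pattern n) → Exhibits φ (cone P) →
                           (∀ z → I P z → Nonempty (proj₁ z)) →
                           Exhibits (BigConj (suc m) φ) P
BigConj-exhibits-of-cone φ P (c , consistent , inconsistent) nonempty =
  apexTuples φ c , consistent′ , inconsistent′
  where
  consistent′ : ∀ y → C P y → Consistent (BigConj _ φ) (apexTuples φ c) y
  consistent′ Y cY =
    Product.map₂ (realizes-cone⇒realizes-BigConj φ c) (consistent (coneCond Y) (coned cY))
  inconsistent′ : ∀ z → I P z → ¬ Consistent (BigConj _ φ) (apexTuples φ c) z
  inconsistent′ Z iZ (x , realizes) =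
    inconsistent (coneCond Z) (coned iZ) (x , realizes-BigConj⇒realizes-cone φ c φc₀ realizes)
    where
    φc₀ : φ x (c zero)
    φc₀ = proj₁ realizes _ (proj₂ (nonempty Z iZ)) (suc zero)

proposition6p5 : {X Y : Set} (φ : X → Y → Set) (k : ℕ) → 1 < k →
    PM (suc k) φ → PM k (BigConj k φ)
proposition6p5 φ (suc k) (s≤s _) PMφ n P reasonable positive size =
  BigConj-exhibits-of-cone φ P
    (PMφ (suc n) (cone P) (cone-reasonable P reasonable) (cone-positive P positive) (cone-size P size))
    (λ z iZ → 0<∣p∣⇒Nonempty (proj₁ z) (subst (0 <_) (sym (size z iZ)) z<s))
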